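{- If $n\ge 3$, then $\mathrm{sg}(P_n\,\square\, P_3) = 4$.
   Context: $P_n$ is the path on $n$ vertices and $\square$ denotes the Cartesian product of graphs (vertex set $V(G)\times V(H)$, $(g,h)\sim(g',h')$ iff either $g=g'$ and $hh'\in E(H)$, or $h=h'$ and $gg'\in E(G)$). For a graph $G$ and $S\subseteq V(G)$, one fixes for each unordered pair $\{x,y\}$ of distinct vertices of $S$ a single shortest $x,y$-path; $S$ is a strong geodetic set if for some such choice the union of the vertex sets of the chosen paths equals $V(G)$. $\mathrm{sg}(G)$ is the minimum size of a strong geodetic set. -}

module Defs where

open import Data.Nat using (ℕ; zero; suc; _+_; _≤_)
open import Data.Fin using (Fin; zero; suc; toℕ; fromℕ; inject₁; _<_)
open import Data.Product using (Σ; ∃; ∃-syntax; _×_; _,_)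
open import Data.Sum using (_⊎_)
open import Relation.Binary.PropositionalEquality using (_≡_)
open import Function.Definitions using (Injective)

record Graph : Set₁ where
  field
    V   : Set
    Adj : V → V → Set
open Graph public

P : ℕ → Graph
P n = record
  { V   = Fin n
  ; Adj = λ i j → (suc (toℕ i) ≡ toℕ j) ⊎ (suc (toℕ j) ≡ toℕ i)
  }

_□_ : Graph → Graph → Graph
G □ H = record
  { V   = V G × V H
  ; Adj = λ { (g , h) (g' , h') →
              (g ≡ g' × Adj H h h') ⊎ (h ≡ h' × Adj G g g') }
  }

Walk : (G : Graph) → V G → V G → ℕ → Set
Walk G x y L =
  Σ (Fin (suc L) → V G) λ w →
    (w zero ≡ x) × (w (fromℕ L) ≡ y) ×
    (∀ (i : Fin L) → Adj G (w (inject₁ i)) (w (suc i)))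

-- A shortest x,y-path: a walk from x to y whose length is at most
-- the length of every x,y-walk (such a walk is necessarily a path).
Geodesic : (G : Graph) → V G → V G → Set
Geodesic G x y =
  Σ ℕ λ L → Walk G x y L × (∀ L' → Walk G x y L' → L ≤ L')

OnGeo : (G : Graph) {x y : V G} → V G → Geodesic G x y → Set
OnGeo G v (L , (w , _) , _) = ∃[ i ] (w i ≡ v)

-- S = {S 0, …, S (k-1)} (k distinct vertices) is a strong geodetic set:
-- one can choose, for every unordered pair {S i, S j} (i < j), a shortest
-- S i,S j-path such that these paths cover all vertices.
StrongGeodetic : (G : Graph) (k : ℕ) → (Fin k → V G) → Set
StrongGeodetic G k S =
  Injective _≡_ _≡_ S ×
  Σ ((i j : Fin k) → i < j → Geodesic G (S i) (S j)) λ c →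
    ∀ (v : V G) → ∃[ i ] ∃[ j ] Σ (i < j) λ i<j → OnGeo G v (c i j i<j)

SgEq : Graph → ℕ → Set
SgEq G k =
  (Σ (Fin k → V G) λ S → StrongGeodetic G k S) ×
  (∀ (m : ℕ) (S : Fin m → V G) → StrongGeodetic G m S → k ≤ m)

module Submission where

-- Upper bound: in the grid with rows 0 … n-1 and columns 0, 1, 2 take the
-- terminals (0,0), (n-1,0), (n-1,1), (n-1,2).  For the pair (0,0), (n-1,c)
-- choose the geodesic that first walks along row 0 to column c and then runs
-- through the whole column c; these three geodesics already cover the grid.
--
-- Lower bound: every geodesic is at most as long as the grid distance
-- |Δrow| + |Δcol|.  A single geodesic has at most (n-1) + 2 + 1 < 3n vertices;
-- three geodesics joining three terminals have at most L₁ + L₂ + L₃ distinct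
-- vertices (each terminal is an endpoint of two of them), and this sum is at
-- most the perimeter bound 2(n-1) + 2·2 < 3n.

open import Defs
open import Data.Nat using (ℕ; zero; suc; _+_; _*_; _≤_; _<_; ∣_-_∣; z≤n; s≤s)
open import Data.Nat.Properties
open import Data.Nat.Tactic.RingSolver using (solve-∀)
open import Algebra.Properties.CommutativeSemigroup +-commutativeSemigroup
  using (x∙yz≈y∙xz; interchange)
open import Data.Fin as Fin using (Fin; zero; suc; toℕ; fromℕ; inject₁; splitAt; join)
open import Data.Fin.Properties
  using (toℕ≤pred[n]; ≤fromℕ; injective⇒≤; splitAt-join; *↔×)
open import Data.Product using (Σ; ∃-syntax; _,_; proj₁; proj₂)
open import Data.Sum using (_⊎_; inj₁; inj₂; [_,_])
open import Data.Empty using (⊥-elim)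
open import Function using (_↔_; Inverse; Injective; _∘_)
open import Relation.Nullary using (¬_; contradiction)
open import Relation.Binary.PropositionalEquality
  using (_≡_; _≢_; refl; sym; trans; cong; cong₂; subst; module ≡-Reasoning)

-- A route of length L from x to y is a sequence of L edges.  Routes are easy
-- to build and to induct on; they translate to and from the walks of Defs.
data Route (G : Graph) : V G → V G → ℕ → Set where
  []  : ∀ {x} → Route G x x 0
  _∷_ : ∀ {x y z L} → Adj G x y → Route G y z L → Route G x z (suc L)

infixr 5 _∷_

module _ {G : Graph} where

  infixr 5 _++_

  vertex : ∀ {x y L} → Route G x y L → Fin (suc L) → V G
  vertex {x} []      _       = x
  vertex {x} (_ ∷ p) zero    = x
  vertex     (_ ∷ p) (suc i) = vertex p i

  vertex-first : ∀ {x y L} (p : Route G x y L) → vertex p zero ≡ x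
  vertex-first []      = refl
  vertex-first (_ ∷ p) = refl

  vertex-last : ∀ {x y L} (p : Route G x y L) → vertex p (fromℕ L) ≡ y
  vertex-last []      = refl
  vertex-last (_ ∷ p) = vertex-last p

  vertex-step : ∀ {x y L} (p : Route G x y L) (i : Fin L) →
                Adj G (vertex p (inject₁ i)) (vertex p (suc i))
  vertex-step (a ∷ p) zero    = subst (Adj G _) (sym (vertex-first p)) a
  vertex-step (_ ∷ p) (suc i) = vertex-step p i

  toWalk : ∀ {x y L} → Route G x y L → Walk G x y L
  toWalk p = vertex p , vertex-first p , vertex-last p , vertex-step p

  fromWalk : ∀ {x y} L → Walk G x y L → Route G x y L
  fromWalk zero    (w , w₀≡x , w₀≡y , _) =
    subst (λ z → Route G z _ 0) (trans (sym w₀≡y) w₀≡x) []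
  fromWalk (suc L) (w , w₀≡x , wL≡y , step) =
    subst (λ z → Route G z _ (suc L)) w₀≡x
      (step zero ∷ fromWalk L (w ∘ suc , refl , wL≡y , step ∘ suc))

  Visits : ∀ {x y L} → V G → Route G x y L → Set
  Visits {x} v []      = v ≡ x
  Visits {x} v (_ ∷ p) = v ≡ x ⊎ Visits v p

  visits⇒vertex : ∀ {x y L v} (p : Route G x y L) → Visits v p → ∃[ i ] vertex p i ≡ v
  visits⇒vertex []      v≡x       = zero , sym v≡x
  visits⇒vertex (_ ∷ p) (inj₁ v≡x) = zero , sym v≡x
  visits⇒vertex (_ ∷ p) (inj₂ v∈p) with i , eq ← visits⇒vertex p v∈p = suc i , eq

  _++_ : ∀ {x y z L M} → Route G x y L → Route G y z M → Route G x z (L + M)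
  []      ++ q = q
  (a ∷ p) ++ q = a ∷ (p ++ q)

  visits-++ʳ : ∀ {x y z L M v} (p : Route G x y L) (q : Route G y z M) →
               Visits v q → Visits v (p ++ q)
  visits-++ʳ []      q v∈q = v∈q
  visits-++ʳ (_ ∷ p) q v∈q = inj₂ (visits-++ʳ p q v∈q)

  module _ (adj-sym : ∀ {x y} → Adj G x y → Adj G y x) where

    _∷ʳ_ : ∀ {x y z L} → Route G x y L → Adj G y z → Route G x z (suc L)
    []      ∷ʳ a = a ∷ []
    (b ∷ p) ∷ʳ a = b ∷ (p ∷ʳ a)

    reverse : ∀ {x y L} → Route G x y L → Route G y x L
    reverse []      = []
    reverse (a ∷ p) = reverse p ∷ʳ adj-sym a

module _ {G H : Graph} (f : V G → V H) (f-adj : ∀ {x y} → Adj G x y → Adj H (f x) (f y)) where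

  map : ∀ {x y L} → Route G x y L → Route H (f x) (f y) L
  map []      = []
  map (a ∷ p) = f-adj a ∷ map p

  visits-map : ∀ {x y L v} (p : Route G x y L) → Visits v p → Visits (f v) (map p)
  visits-map []      v≡x        = cong f v≡x
  visits-map (_ ∷ p) (inj₁ v≡x) = inj₁ (cong f v≡x)
  visits-map (_ ∷ p) (inj₂ v∈p) = inj₂ (visits-map p v∈p)

-- A potential on G vanishes on the diagonal and drops by at most one along
-- an edge; it is therefore a lower bound for the length of every walk.
record Potential (G : Graph) : Set where
  field
    dist      : V G → V G → ℕ
    dist-self : ∀ x → dist x x ≡ 0
    dist-step : ∀ {x y} → Adj G x y → ∀ z → dist x z ≤ suc (dist y z)
open Potential

module _ {G : Graph} (D : Potential G) where

  route-length-bound : ∀ {x y L} → Route G x y L → dist D x y ≤ L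
  route-length-bound {x} [] = ≤-reflexive (dist-self D x)
  route-length-bound (a ∷ p) = ≤-trans (dist-step D a _) (s≤s (route-length-bound p))

  geodesic : ∀ {x y L} → Route G x y L → L ≤ dist D x y → Geodesic G x y
  geodesic {L = L} p L≤d =
    L , toWalk p , λ L' w → ≤-trans L≤d (route-length-bound (fromWalk L' w))

geodesic-shortest : ∀ {G x y L} (g : Geodesic G x y) → Route G x y L → proj₁ g ≤ L
geodesic-shortest (_ , _ , shortest) p = shortest _ (toWalk p)

module _ {G H : Graph} (D : Potential G) (E : Potential H) where

  product-dist : V (G □ H) → V (G □ H) → ℕ
  product-dist (g , h) (g' , h') = dist D g g' + dist E h h'

  product-dist-step : ∀ {x y} → Adj (G □ H) x y → ∀ z → product-dist x z ≤ suc (product-dist y z)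
  product-dist-step {g , h} (inj₁ (refl , a)) (g' , h') =
    ≤-trans (+-monoʳ-≤ (dist D g g') (dist-step E a h')) (≤-reflexive (+-suc _ _))
  product-dist-step {g , h} (inj₂ (refl , a)) (g' , h') =
    +-monoˡ-≤ (dist E h h') (dist-step D a g')

  _⊠_ : Potential (G □ H)
  _⊠_ = record
    { dist      = product-dist
    ; dist-self = λ { (g , h) → cong₂ _+_ (dist-self D g) (dist-self E h) }
    ; dist-step = product-dist-step
    }

adj-sym-P : ∀ {k} {i j : Fin k} → Adj (P k) i j → Adj (P k) j i
adj-sym-P (inj₁ e) = inj₂ e
adj-sym-P (inj₂ e) = inj₁ e

shift-adj : ∀ {k} {i j : Fin k} → Adj (P k) i j → Adj (P (suc k)) (suc i) (suc j)
shift-adj (inj₁ e) = inj₁ (cong suc e)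
shift-adj (inj₂ e) = inj₂ (cong suc e)

∣n-suc-n∣≡1 : ∀ n → ∣ n - suc n ∣ ≡ 1
∣n-suc-n∣≡1 zero    = refl
∣n-suc-n∣≡1 (suc n) = ∣n-suc-n∣≡1 n

adjacent-gap : ∀ {k} {i j : Fin k} → Adj (P k) i j → ∣ toℕ i - toℕ j ∣ ≡ 1
adjacent-gap {i = i} (inj₁ e) = trans (cong (∣ toℕ i -_∣) (sym e)) (∣n-suc-n∣≡1 (toℕ i))
adjacent-gap {j = j} (inj₂ e) =
  trans (cong (∣_- toℕ j ∣) (sym e)) (trans (∣-∣-comm (suc (toℕ j)) (toℕ j)) (∣n-suc-n∣≡1 (toℕ j)))

path-potential : ∀ k → Potential (P k)
path-potential k = record
  { dist      = λ i j → ∣ toℕ i - toℕ j ∣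
  ; dist-self = λ i → ∣n-n∣≡0 (toℕ i)
  ; dist-step = λ {i} {j} i~j z →
      ≤-trans (∣-∣-triangle (toℕ i) (toℕ j) (toℕ z))
              (≤-reflexive (cong (_+ ∣ toℕ j - toℕ z ∣) (adjacent-gap i~j)))
  }

ascent : ∀ {k} (j : Fin (suc k)) → Route (P (suc k)) zero j (toℕ j)
ascent         zero    = []
ascent {suc k} (suc j) = inj₁ refl ∷ map suc shift-adj (ascent j)

ascent-visits : ∀ {k} (j r : Fin (suc k)) → toℕ r ≤ toℕ j → Visits r (ascent j)
ascent-visits         zero    zero    _         = refl
ascent-visits {suc k} (suc j) zero    _         = inj₁ refl
ascent-visits {suc k} (suc j) (suc r) (s≤s r≤j) =
  inj₂ (visits-map suc shift-adj (ascent j) (ascent-visits j r r≤j))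

segment : ∀ {k} (i j : Fin k) → Route (P k) i j ∣ toℕ i - toℕ j ∣
segment zero    j       = ascent j
segment (suc i) zero    = reverse adj-sym-P (ascent (suc i))
segment (suc i) (suc j) = map suc shift-adj (segment i j)

coordinate-gap : ∀ {k} (i j : Fin (suc k)) → ∣ toℕ i - toℕ j ∣ ≤ k
coordinate-gap i j = ≤-trans (∣m-n∣≤m⊔n (toℕ i) (toℕ j)) (⊔-lub (toℕ≤pred[n] i) (toℕ≤pred[n] j))

perimeter : ℕ → ℕ → ℕ → ℕ
perimeter x y z = ∣ x - y ∣ + (∣ x - z ∣ + ∣ y - z ∣)

perimeter-swap₁₂ : ∀ x y z → perimeter x y z ≡ perimeter y x z
perimeter-swap₁₂ x y z =
  cong₂ _+_ (∣-∣-comm x y) (+-comm ∣ x - z ∣ ∣ y - z ∣)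

perimeter-swap₂₃ : ∀ x y z → perimeter x y z ≡ perimeter x z y
perimeter-swap₂₃ x y z = trans (cong (λ t → ∣ x - y ∣ + (∣ x - z ∣ + t)) (∣-∣-comm y z))
                                 (x∙yz≈y∙xz ∣ x - y ∣ ∣ x - z ∣ ∣ z - y ∣)

-- For x ≤ y ≤ z ≤ M the perimeter is 2(z - x) ≤ 2M.
perimeter-sorted : ∀ {M x y z} → x ≤ y → y ≤ z → z ≤ M → perimeter x y z ≤ 2 * M
perimeter-sorted {M} {x} x≤y y≤z z≤M
  with p , refl ← m≤n⇒∃[o]m+o≡n x≤y
  with q , refl ← m≤n⇒∃[o]m+o≡n y≤z = begin
    perimeter x (x + p) (x + p + q) ≡⟨ cong₂ _+_ (∣m-m+n∣≡n x p) (cong₂ _+_ x-to-z (∣m-m+n∣≡n (x + p) q)) ⟩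
    p + ((p + q) + q)               ≡⟨ twice p q ⟩
    2 * (p + q)                     ≤⟨ *-monoʳ-≤ 2 p+q≤M ⟩
    2 * M                           ∎
  where
  open ≤-Reasoning
  x-to-z : ∣ x - x + p + q ∣ ≡ p + q
  x-to-z = trans (cong ∣ x -_∣ (+-assoc x p q)) (∣m-m+n∣≡n x (p + q))
  p+q≤M : p + q ≤ M
  p+q≤M = ≤-trans (m≤n+m (p + q) x) (≤-trans (≤-reflexive (sym (+-assoc x p q))) z≤M)
  twice : ∀ p q → p + ((p + q) + q) ≡ 2 * (p + q)
  twice = solve-∀

perimeter-bound-≤ : ∀ {M} x y z → x ≤ y → y ≤ M → z ≤ M → perimeter x y z ≤ 2 * M
perimeter-bound-≤ x y z x≤y y≤M z≤M with ≤-total y z | ≤-total x z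
... | inj₁ y≤z | _        = perimeter-sorted x≤y y≤z z≤M
... | inj₂ z≤y | inj₁ x≤z =
  ≤-trans (≤-reflexive (perimeter-swap₂₃ x y z)) (perimeter-sorted x≤z z≤y y≤M)
... | inj₂ z≤y | inj₂ z≤x =
  ≤-trans (≤-reflexive (trans (perimeter-swap₂₃ x y z) (perimeter-swap₁₂ x z y)))
          (perimeter-sorted z≤x x≤y y≤M)

perimeter-bound : ∀ {M} x y z → x ≤ M → y ≤ M → z ≤ M → perimeter x y z ≤ 2 * M
perimeter-bound x y z x≤M y≤M z≤M with ≤-total x y
... | inj₁ x≤y = perimeter-bound-≤ x y z x≤y y≤M z≤M
... | inj₂ y≤x = ≤-trans (≤-reflexive (perimeter-swap₁₂ x y z)) (perimeter-bound-≤ y x z y≤x x≤M z≤M)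

module _ {n m : ℕ} where

  row-gap column-gap : V (P n □ P m) → V (P n □ P m) → ℕ
  row-gap    (g , _) (g' , _) = ∣ toℕ g - toℕ g' ∣
  column-gap (_ , h) (_ , h') = ∣ toℕ h - toℕ h' ∣

  grid-route : (x y : V (P n □ P m)) → Route (P n □ P m) x y (column-gap x y + row-gap x y)
  grid-route (g , h) (g' , h') =
    map (g ,_) (λ h~h' → inj₁ (refl , h~h')) (segment h h') ++
    map (_, h') (λ g~g' → inj₂ (refl , g~g')) (segment g g')

  -- Its length is the product potential of the two path potentials, so it is a geodesic.
  grid-geodesic : (x y : V (P n □ P m)) → Geodesic (P n □ P m) x y
  grid-geodesic x y = geodesic (path-potential n ⊠ path-potential m) (grid-route x y)
                               (≤-reflexive (+-comm (column-gap x y) (row-gap x y)))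

  grid-triangle : ∀ x y z →
    (column-gap x y + row-gap x y) + ((column-gap x z + row-gap x z) + (column-gap y z + row-gap y z))
    ≡ perimeter (toℕ (proj₂ x)) (toℕ (proj₂ y)) (toℕ (proj₂ z))
      + perimeter (toℕ (proj₁ x)) (toℕ (proj₁ y)) (toℕ (proj₁ z))
  grid-triangle x y z =
    trans (cong (column-gap x y + row-gap x y +_)
                (interchange (column-gap x z) (row-gap x z) (column-gap y z) (row-gap y z)))
          (interchange (column-gap x y) (row-gap x y) _ _)

grid-route-column : ∀ {k m} {h : Fin m} (y : V (P (suc k) □ P m)) (r : Fin (suc k)) →
                    toℕ r ≤ toℕ (proj₁ y) → Visits (r , proj₂ y) (grid-route (zero , h) y)
grid-route-column {h = h} (g' , h') r r≤g' =
  visits-++ʳ (map (zero ,_) (λ h~h' → inj₁ (refl , h~h')) (segment h h'))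
             (map (_, h') (λ g~g' → inj₂ (refl , g~g')) (ascent g'))
             (visits-map (_, h') (λ g~g' → inj₂ (refl , g~g')) (ascent g') (ascent-visits g' r r≤g'))

InImage : ∀ {X : Set} {A} → (Fin A → X) → X → Set
InImage f x = ∃[ i ] f i ≡ x

cover-size : ∀ {X : Set} {M N} → Fin N ↔ X → (f : Fin M → X) → (∀ x → InImage f x) → N ≤ M
cover-size {X} {M} e f onto = injective⇒≤ {f = pick ∘ to} pick∘to-injective
  where
  open Inverse e
  pick : X → Fin M
  pick x = proj₁ (onto x)
  pick∘to-injective : ∀ {a b} → pick (to a) ≡ pick (to b) → a ≡ b
  pick∘to-injective {a} {b} eq = begin
    a                        ≡⟨ strictlyInverseʳ a ⟨
    from (to a)              ≡⟨ cong from (proj₂ (onto (to a))) ⟨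
    from (f (pick (to a)))   ≡⟨ cong (from ∘ f) eq ⟩
    from (f (pick (to b)))   ≡⟨ cong from (proj₂ (onto (to b))) ⟩
    from (to b)              ≡⟨ strictlyInverseʳ b ⟩
    b                        ∎
    where open ≡-Reasoning

_⊕_ : ∀ {X : Set} {A B} → (Fin A → X) → (Fin B → X) → Fin (A + B) → X
_⊕_ {A = A} f g = [ f , g ] ∘ splitAt A

image-⊕ˡ : ∀ {X : Set} {A B} {f : Fin A → X} {g : Fin B → X} {x} → InImage f x → InImage (f ⊕ g) x
image-⊕ˡ {A = A} {B} {f} {g} (i , fi≡x) = join A B (inj₁ i) , trans (cong [ f , g ] (splitAt-join A B (inj₁ i))) fi≡x

image-⊕ʳ : ∀ {X : Set} {A B} {f : Fin A → X} {g : Fin B → X} {x} → InImage g x → InImage (f ⊕ g) x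
image-⊕ʳ {A = A} {B} {f} {g} (i , gi≡x) = join A B (inj₂ i) , trans (cong [ f , g ] (splitAt-join A B (inj₂ i))) gi≡x

last-or-inject₁ : ∀ {L} (j : Fin (suc L)) → j ≡ fromℕ L ⊎ ∃[ t ] j ≡ inject₁ t
last-or-inject₁ {zero}  zero    = inj₁ refl
last-or-inject₁ {suc L} zero    = inj₂ (zero , refl)
last-or-inject₁ {suc L} (suc j) with last-or-inject₁ j
... | inj₁ j≡last      = inj₁ (cong suc j≡last)
... | inj₂ (t , j≡t)   = inj₂ (suc t , cong suc j≡t)

-- Geodesics g₁ : s₀ ⇝ s₁, g₂ : s₀ ⇝ s₂ and g₃ : s₁ ⇝ s₂ with s₂ ∉ {s₀, s₁}
-- have at most L₁ + L₂ + L₃ vertices together: every terminal is an endpoint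
-- of two of them, so g₂ minus its start and g₃ minus both ends, together with
-- all of g₁, already enumerate them.
triangle-cover : ∀ {G : Graph} {N s₀ s₁ s₂} → Fin N ↔ V G →
  (g₁ : Geodesic G s₀ s₁) (g₂ : Geodesic G s₀ s₂) (g₃ : Geodesic G s₁ s₂) →
  s₀ ≢ s₂ → s₁ ≢ s₂ → (∀ v → OnGeo G v g₁ ⊎ OnGeo G v g₂ ⊎ OnGeo G v g₃) →
  N ≤ proj₁ g₁ + (proj₁ g₂ + proj₁ g₃)
triangle-cover e g₁ (zero , (_ , first₂ , last₂ , _) , _) g₃ s₀≢s₂ _ _ =
  contradiction (trans (sym first₂) last₂) s₀≢s₂
triangle-cover e g₁ (suc _ , _) (zero , (_ , first₃ , last₃ , _) , _) _ s₁≢s₂ _ =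
  contradiction (trans (sym first₃) last₃) s₁≢s₂
triangle-cover {G} {N} e (L₁ , (w₁ , first₁ , last₁ , _) , _) (suc L₂ , (w₂ , first₂ , last₂ , _) , _)
               (suc L₃ , (w₃ , first₃ , last₃ , _) , _) _ _ covered =
  subst (N ≤_) size (cover-size e enumeration enumerated)
  where
  enumeration : Fin (suc L₁ + (suc L₂ + L₃)) → V G
  enumeration = w₁ ⊕ ((w₂ ∘ suc) ⊕ (w₃ ∘ suc ∘ inject₁))
  size : suc L₁ + (suc L₂ + L₃) ≡ L₁ + (suc L₂ + suc L₃)
  size = trans (sym (+-suc L₁ _)) (cong (L₁ +_) (sym (+-suc (suc L₂) L₃)))
  from-g₁ : ∀ {v} → InImage w₁ v → InImage enumeration v
  from-g₁ = image-⊕ˡ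
  from-g₂ : ∀ {v} → InImage (w₂ ∘ suc) v → InImage enumeration v
  from-g₂ = image-⊕ʳ {f = w₁} ∘ image-⊕ˡ
  from-g₃ : ∀ {v} → InImage (w₃ ∘ suc ∘ inject₁) v → InImage enumeration v
  from-g₃ = image-⊕ʳ {f = w₁} ∘ image-⊕ʳ {f = w₂ ∘ suc}
  enumerated : ∀ v → InImage enumeration v
  enumerated v with covered v
  ... | inj₁ on₁                     = from-g₁ on₁
  ... | inj₂ (inj₁ (zero , s₀≡v))    = from-g₁ (zero , trans first₁ (trans (sym first₂) s₀≡v))
  ... | inj₂ (inj₁ (suc t , w₂t≡v))  = from-g₂ (t , w₂t≡v)
  ... | inj₂ (inj₂ (zero , s₁≡v))    = from-g₁ (fromℕ L₁ , trans last₁ (trans (sym first₃) s₁≡v))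
  ... | inj₂ (inj₂ (suc j , w₃j≡v)) with last-or-inject₁ j
  ...   | inj₁ refl       = from-g₂ (fromℕ L₂ , trans last₂ (trans (sym last₃) w₃j≡v))
  ...   | inj₂ (t , refl) = from-g₃ (t , w₃j≡v)

on-chosen : ∀ {G k} {S : Fin k → V G} (chosen : (i j : Fin k) → i Fin.< j → Geodesic G (S i) (S j))
            {i j v} (p q : i Fin.< j) → OnGeo G v (chosen i j p) → OnGeo G v (chosen i j q)
on-chosen {G} chosen {v = v} p q = subst (λ r → OnGeo G v (chosen _ _ r)) (<-irrelevant p q)

module _ (k : ℕ) where

  terminal : Fin 4 → V (P (suc (suc k)) □ P 3)
  terminal zero    = zero , zero
  terminal (suc c) = fromℕ (suc k) , c

  terminal-injective : Injective _≡_ _≡_ terminal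
  terminal-injective {zero}  {zero}  _  = refl
  terminal-injective {suc c} {suc d} eq = cong (suc ∘ proj₂) eq

  -- Pair (0,0) with (n-1,c): the grid route between them covers column c.
  four-terminals : Σ (Fin 4 → V (P (suc (suc k)) □ P 3)) λ S → StrongGeodetic (P (suc (suc k)) □ P 3) 4 S
  four-terminals =
    terminal , terminal-injective , (λ i j _ → grid-geodesic (terminal i) (terminal j)) ,
    λ { (r , c) → zero , suc c , s≤s z≤n ,
                  visits⇒vertex (grid-route (terminal zero) (terminal (suc c)))
                    (grid-route-column (terminal (suc c)) r (≤fromℕ r)) }

module _ (s : ℕ) where

  Grid : Graph
  Grid = P (3 + s) □ P 3

  geodesic-length : ∀ {x y} (g : Geodesic Grid x y) → proj₁ g ≤ column-gap x y + row-gap x y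
  geodesic-length {x} {y} g = geodesic-shortest g (grid-route x y)

  one-geodesic-too-short : ∀ {x y} (g : Geodesic Grid x y) → ¬ (∀ v → OnGeo Grid v g)
  one-geodesic-too-short {x , h} {y , h'} g covers = <⇒≱ n+2<3n (begin
    (3 + s) * 3                                ≤⟨ cover-size *↔× _ covers ⟩
    suc (proj₁ g)                              ≤⟨ s≤s (geodesic-length g) ⟩
    suc (∣ toℕ h - toℕ h' ∣ + ∣ toℕ x - toℕ y ∣) ≤⟨ s≤s (+-mono-≤ (coordinate-gap h h') (coordinate-gap x y)) ⟩
    suc (2 + (2 + s))                          ∎)
    where
    open ≤-Reasoning
    n+2<3n : suc (2 + (2 + s)) < (3 + s) * 3
    n+2<3n = ≤-trans (m≤m+n _ (3 + 2 * s)) (≤-reflexive (gap s))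
      where
      gap : ∀ t → suc (suc (2 + (2 + t))) + (3 + 2 * t) ≡ (3 + t) * 3
      gap = solve-∀

  three-geodesics-too-short : ∀ {s₀ s₁ s₂} (g₁ : Geodesic Grid s₀ s₁) (g₂ : Geodesic Grid s₀ s₂)
    (g₃ : Geodesic Grid s₁ s₂) → s₀ ≢ s₂ → s₁ ≢ s₂ →
    ¬ (∀ v → OnGeo Grid v g₁ ⊎ OnGeo Grid v g₂ ⊎ OnGeo Grid v g₃)
  three-geodesics-too-short {x₀ , h₀} {x₁ , h₁} {x₂ , h₂} g₁ g₂ g₃ s₀≢s₂ s₁≢s₂ covers =
    <⇒≱ perimeters<3n (begin
      (3 + s) * 3                           ≤⟨ triangle-cover {Grid} *↔× g₁ g₂ g₃ s₀≢s₂ s₁≢s₂ covers ⟩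
      proj₁ g₁ + (proj₁ g₂ + proj₁ g₃)      ≤⟨ +-mono-≤ (geodesic-length g₁)
                                                 (+-mono-≤ (geodesic-length g₂) (geodesic-length g₃)) ⟩
      _                                     ≡⟨ grid-triangle (x₀ , h₀) (x₁ , h₁) (x₂ , h₂) ⟩
      perimeter (toℕ h₀) (toℕ h₁) (toℕ h₂) + perimeter (toℕ x₀) (toℕ x₁) (toℕ x₂)
                                            ≤⟨ +-mono-≤ (perimeter-bound _ _ _ (toℕ≤pred[n] h₀) (toℕ≤pred[n] h₁) (toℕ≤pred[n] h₂))
                                                        (perimeter-bound _ _ _ (toℕ≤pred[n] x₀) (toℕ≤pred[n] x₁) (toℕ≤pred[n] x₂)) ⟩
      2 * 2 + 2 * (2 + s)                   ∎)
    where
    open ≤-Reasoning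
    perimeters<3n : 2 * 2 + 2 * (2 + s) < (3 + s) * 3
    perimeters<3n = ≤-trans (m≤m+n _ s) (≤-reflexive (gap s))
      where
      gap : ∀ t → suc (2 * 2 + 2 * (2 + t)) + t ≡ (3 + t) * 3
      gap = solve-∀

  at-least-four : ∀ m (S : Fin m → V Grid) → StrongGeodetic Grid m S → 4 ≤ m
  at-least-four 0 S (_ , _ , covered) with covered (zero , zero)
  ... | () , _
  at-least-four 1 S (_ , _ , covered) with covered (zero , zero)
  ... | zero , zero , () , _
  at-least-four 2 S (_ , chosen , covered) = ⊥-elim (one-geodesic-too-short g₀₁ on-g₀₁)
    where
    g₀₁ : Geodesic Grid (S zero) (S (suc zero))
    g₀₁ = chosen zero (suc zero) (s≤s z≤n)
    on-g₀₁ : ∀ v → OnGeo Grid v g₀₁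
    on-g₀₁ v with covered v
    ... | zero     , suc zero , p      , on = on-chosen {Grid} chosen p _ on
    ... | zero     , zero     , ()     , _
    ... | suc zero , zero     , ()     , _
    ... | suc zero , suc zero , s≤s () , _
  at-least-four 3 S (injective , chosen , covered) =
    ⊥-elim (three-geodesics-too-short g₀₁ g₀₂ g₁₂ s₀≢s₂ s₁≢s₂ on-g)
    where
    g₀₁ : Geodesic Grid (S zero) (S (suc zero))
    g₀₁ = chosen zero (suc zero) (s≤s z≤n)
    g₀₂ : Geodesic Grid (S zero) (S (suc (suc zero)))
    g₀₂ = chosen zero (suc (suc zero)) (s≤s z≤n)
    g₁₂ : Geodesic Grid (S (suc zero)) (S (suc (suc zero)))
    g₁₂ = chosen (suc zero) (suc (suc zero)) (s≤s (s≤s z≤n))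
    s₀≢s₂ : S zero ≢ S (suc (suc zero))
    s₀≢s₂ eq = contradiction (injective eq) λ ()
    s₁≢s₂ : S (suc zero) ≢ S (suc (suc zero))
    s₁≢s₂ eq = contradiction (injective eq) λ ()
    on-g : ∀ v → OnGeo Grid v g₀₁ ⊎ OnGeo Grid v g₀₂ ⊎ OnGeo Grid v g₁₂
    on-g v with covered v
    ... | zero           , suc zero       , p              , on = inj₁ (on-chosen {Grid} chosen p _ on)
    ... | zero           , suc (suc zero) , p              , on = inj₂ (inj₁ (on-chosen {Grid} chosen p _ on))
    ... | suc zero       , suc (suc zero) , p              , on = inj₂ (inj₂ (on-chosen {Grid} chosen p _ on))
    ... | zero           , zero           , ()             , _
    ... | suc zero       , zero           , ()             , _
    ... | suc zero       , suc zero       , s≤s ()         , _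
    ... | suc (suc zero) , zero           , ()             , _
    ... | suc (suc zero) , suc zero       , s≤s ()         , _
    ... | suc (suc zero) , suc (suc zero) , s≤s (s≤s ())   , _
  at-least-four (suc (suc (suc (suc m)))) _ _ = s≤s (s≤s (s≤s (s≤s z≤n)))

proposition5p3 : (n : ℕ) → 3 ≤ n → SgEq (P n □ P 3) 4
proposition5p3 (suc (suc zero)) (s≤s (s≤s ()))
proposition5p3 (suc (suc (suc s))) _           = four-terminals (suc s) , at-least-four s
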